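{- Let $G=(V,E)$ be the complete graph, let $0<\beta\le1$, and let $B$ be a $\beta$-critical block (of some sequence of moves) such that some vertex occurs exactly once in $B$. Let $\tau_0\in\{\pm1\}^V$ be an initial configuration. Then $\mathrm{rank}(P_{B,\tau_0})\ge \frac{\beta}{1+2\beta}\,s(B)$.
   Context: A configuration is $\tau\in\{\pm1\}^V$. A sequence of moves is a finite sequence of vertices; for a sequence $L$, $\ell(L)$ is its length, $S(L)$ the set of occurring vertices and $s(L)=|S(L)|$. A block of $L$ is a contiguous subsequence; a block $B$ is $\beta$-critical if $\ell(B)\ge(1+\beta)s(B)$ and $\ell(B')<(1+\beta)s(B')$ for every block $B'$ strictly contained in $B$. Given $\tau_0$, $\tau_t$ is obtained from $\tau_{t-1}$ by flipping the sign of vertex $B(t)$. $M_{B,\tau_0}\in\{0,\pm1\}^{E\times[\ell(B)]}$ has $M_{B,\tau_0}[\{a,b\},t]=+1$ if $B(t)\in\{a,b\}$ and $\tau_t(a)\ne\tau_t(b)$, $-1$ if $B(t)\in\{a,b\}$ and $\tau_t(a)=\tau_t(b)$, $0$ otherwise. A pair for $v$ is $(t_1,t_2)$ with $t_1<t_2$, $B(t_1)=B(t_2)=v$, $B(t)\ne v$ for $t_1<t<t_2$; $\Gamma(B)$ is the set of all pairs; $P_{B,\tau_0}\in\mathbb{Z}^{E\times\Gamma(B)}$ has $P_{B,\tau_0}[\{a,b\},(t_1,t_2)]=M_{B,\tau_0}[\{a,b\},t_1]+M_{B,\tau_0}[\{a,b\},t_2]$.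
   Formalization: The parameter β takes only rational values in the interval (0,1]. -}

module Defs where

open import Data.Nat as ℕ using (ℕ; zero; suc)
open import Data.Fin as Fin using (Fin)
open import Data.Fin.Properties using () renaming (_≟_ to _≟ᶠ_)
open import Data.Bool using (Bool; true; false; not; if_then_else_)
open import Data.Integer as ℤ using (ℤ; +_; -[1+_])
open import Data.Rational as ℚ using (ℚ; 0ℚ; 1ℚ)
open import Data.List using (List; []; _∷_; length; lookup; take; filter; _++_)
open import Data.List.Relation.Unary.Any using (Any; any?)
open import Data.Product using (Σ; ∃; _×_; _,_)
open import Data.Sum using (_⊎_)
open import Relation.Binary.PropositionalEquality using (_≡_; _≢_)
open import Relation.Nullary.Decidable using (does)
open import Data.Bool.Properties using () renaming (_≟_ to _≟ᵇ_)

-- The complete graph K_n on vertex set V = Fin n.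
-- Edges {a,b} are represented as (a , b) with a < b.
Edge : ℕ → Set
Edge n = Σ (Fin n × Fin n) λ { (a , b) → a Fin.< b }

Seq : ℕ → Set
Seq n = List (Fin n)

ℓ : ∀ {n} → Seq n → ℕ
ℓ = length

s : ∀ {n} → Seq n → ℕ
s {n} L = length (filter (λ v → any? (v ≟ᶠ_) L) (Data.List.allFin n))
  where import Data.List

count : ∀ {n} → Fin n → Seq n → ℕ
count v L = length (filter (λ u → u ≟ᶠ v) L)

ℕtoℚ : ℕ → ℚ
ℕtoℚ k = + k ℚ./ 1

StrictSubBlock : ∀ {n} → Seq n → Seq n → Set
StrictSubBlock {n} B' B =
  Σ (Seq n) λ xs → Σ (Seq n) λ ys →
    (xs ++ B' ++ ys ≡ B) × (0 ℕ.< length B') × (length B' ℕ.< length B)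

Critical : ∀ {n} → ℚ → Seq n → Set
Critical β B =
  ((1ℚ ℚ.+ β) ℚ.* ℕtoℚ (s B) ℚ.≤ ℕtoℚ (ℓ B)) ×
  (∀ B' → StrictSubBlock B' B → ℕtoℚ (ℓ B') ℚ.< (1ℚ ℚ.+ β) ℚ.* ℕtoℚ (s B'))

-- configurations τ ∈ {±1}^V, encoded as Bool (true = +1, false = -1)
Config : ℕ → Set
Config n = Fin n → Bool

flip : ∀ {n} → Config n → Fin n → Config n
flip τ v u = if does (u ≟ᶠ v) then not (τ u) else τ u

run : ∀ {n} → Config n → Seq n → Config n
run τ [] = τ
run τ (v ∷ L) = run (flip τ v) L

-- positions: time t ∈ {1,…,ℓ(B)} is encoded as index i : Fin (ℓ B) with t = i+1.
-- τ_t = configuration after the first t moves.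
τAt : ∀ {n} (B : Seq n) → Config n → Fin (length B) → Config n
τAt B τ₀ i = run τ₀ (take (suc (Fin.toℕ i)) B)

M : ∀ {n} (B : Seq n) → Config n → Edge n → Fin (length B) → ℤ
M B τ₀ ((a , b) , _) i =
  if does (lookup B i ≟ᶠ a) Data.Bool.∨ does (lookup B i ≟ᶠ b)
  then (if does (τAt B τ₀ i a ≟ᵇ τAt B τ₀ i b) then -[1+ 0 ] else + 1)
  else + 0
  where import Data.Bool

Pair : ∀ {n} → Seq n → Set
Pair B = Σ (Fin (length B) × Fin (length B)) λ { (i , j) →
  (i Fin.< j) × (lookup B i ≡ lookup B j) ×
  (∀ k → i Fin.< k → k Fin.< j → lookup B k ≢ lookup B i) }

P : ∀ {n} (B : Seq n) → Config n → Edge n → Pair B → ℤ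
P B τ₀ e ((i , j) , _) = M B τ₀ e i ℤ.+ M B τ₀ e j

sumℚ : ∀ k → (Fin k → ℚ) → ℚ
sumℚ zero f = 0ℚ
sumℚ (suc k) f = f Fin.zero ℚ.+ sumℚ k (λ i → f (Fin.suc i))

LinIndepCols : ∀ {R C : Set} → (R → C → ℤ) → ∀ k → (Fin k → C) → Set
LinIndepCols {R} A k cols =
  (c : Fin k → ℚ) →
  (∀ (r : R) → sumℚ k (λ i → c i ℚ.* (A r (cols i) ℚ./ 1)) ≡ 0ℚ) →
  ∀ i → c i ≡ 0ℚ

RankAtLeast : ∀ {R C : Set} → (R → C → ℤ) → ℕ → Set
RankAtLeast {R} {C} A r = Σ (Fin r → C) λ cols → LinIndepCols A r cols

module Submission where

-- A column of P belongs to a gap, two consecutive moves of a vertex v.  By parity it vanishes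
-- on edges avoiding v, and on an edge {v,w} it is nonzero iff w moves an odd number of times
-- inside the gap: a gap with such a w is a witness.  Witnesses each clearing the rows of the
-- earlier ones form a triangular family, which bounds the rank from below.  With X the number
-- of once-vertices and D of the others (s(B) = X + D) we build two families:
--   greedy: without dense blocks (forbidden by criticality and β ≤ 1) every nonempty set T of
--     repeated vertices has a witness with v ∈ T, w ∉ T; removing v and repeating gives D;
--   runs: B cut at its once-vertices into runs Qᵢ, with M crossing witnesses, Σ s(Qᵢ) ≤ D + M.
-- Criticality gives ℓ(Qᵢ) ≤ (1+β)s(Qᵢ) and (1+β)(X+D) ≤ ℓ(B) = X + Σ ℓ(Qᵢ), so βX ≤ (1+β)M and
-- β s(B) ≤ (1+2β) max(D, M).

open import Defs
open import Data.Nat as ℕ using (ℕ; zero; suc; _+_; _*_; _≤_; _<_; z≤n; s≤s; z<s; _⊔_)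
import Data.Nat.Properties as ℕP
open import Data.Nat.ListAction using (sum)
open import Data.Nat.Solver using () renaming (module +-*-Solver to ℕ-Solver)
import Data.Nat.Coprimality as Coprimality
open import Algebra.Properties.CommutativeMonoid.Sum ℕP.+-0-commutativeMonoid
  using (sum-cong-≗; ∑-distrib-+) renaming (sum to ∑)
open import Data.Fin as Fin using (Fin; toℕ)
import Data.Fin.Properties as FinP
open import Data.Fin.Properties using () renaming (_≟_ to _≟ᶠ_)
open import Data.Bool using (Bool; true; false; not; _∧_; _∨_; _xor_; if_then_else_)
open import Data.Bool.Properties
  using (not-distribˡ-xor; not-distribʳ-xor; xor-identityʳ; ∨-comm; ∧-identityʳ; ¬-not) renaming (_≟_ to _≟ᵇ_)
open import Data.Integer as ℤ using (ℤ)
import Data.Integer.Properties as ℤP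
open import Data.Integer.GCD using (gcd)
open import Data.Rational as ℚ using (ℚ; 0ℚ; 1ℚ; mkℚ; ↥_; toℚᵘ)
import Data.Rational.Properties as ℚP
import Data.Rational.Unnormalised as ℚᵘ
import Data.Rational.Unnormalised.Properties as ℚᵘP
open import Data.Rational.Solver using () renaming (module +-*-Solver to ℚ-Solver)
open import Data.List using (List; []; _∷_; _++_; [_]; length; lookup; take; filter; map; tabulate; allFin)
open import Data.List.Properties
  using (++-assoc; ++-identityʳ; ++-monoid; length-++; length-map; ∷-injective;
         filter-++; filter-accept; filter-reject; filter-none; filter-some; filter-all; length-filter)
open import Data.List.Relation.Unary.Any as Any using (here; there; any?)
open import Data.List.Relation.Unary.All as All using (All; []; _∷_)
import Data.List.Relation.Unary.All.Properties as AllP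
open import Data.List.Relation.Unary.AllPairs as AllPairs using (AllPairs; []; _∷_)
import Data.List.Relation.Unary.AllPairs.Properties as AllPairsP
open import Data.List.Relation.Unary.Unique.Propositional using (Unique)
open import Data.List.Relation.Unary.Unique.Propositional.Properties using (allFin⁺; filter⁺)
open import Data.List.Membership.Propositional using (_∈_; _∉_)
open import Data.List.Membership.Propositional.Properties using (∈-++⁺ˡ; ∈-++⁺ʳ; ∈-++⁻; ∈-∃++; ∈-lookup)
open import Data.List.Relation.Binary.Subset.Propositional using (_⊆_)
open import Data.Product using (Σ; _×_; _,_; proj₁; proj₂)
open import Data.Sum using (_⊎_; inj₁; inj₂)
open import Data.Unit using (⊤; tt)
open import Function using (_∘_)
open import Relation.Binary.Definitions using (tri<; tri≈; tri>)
open import Relation.Binary.PropositionalEquality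
  using (_≡_; _≢_; refl; sym; trans; cong; cong₂; subst; subst₂; module ≡-Reasoning)
open import Relation.Nullary using (¬_; Dec; yes; no; does; contradiction; _×-dec_)
open import Relation.Nullary.Decidable using (dec-true; dec-false)
open import Relation.Unary using (Pred; Decidable)

private
  variable
    n : ℕ

count-self : ∀ (x : Fin n) L → count x (x ∷ L) ≡ suc (count x L)
count-self x L = cong length (filter-accept (_≟ᶠ x) refl)

count-other : ∀ {x y : Fin n} L → y ≢ x → count x (y ∷ L) ≡ count x L
count-other L y≢x = cong length (filter-reject (_≟ᶠ _) y≢x)

count-∷ : ∀ (c : Fin n) L x → count x (c ∷ L) ≡ count x L + (if does (c ≟ᶠ x) then 1 else 0)
count-∷ c L x with c ≟ᶠ x
... | yes refl = ℕP.+-comm 1 (count c L)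
... | no _ = sym (ℕP.+-identityʳ (count x L))

count-++ : ∀ (x : Fin n) A C → count x (A ++ C) ≡ count x A + count x C
count-++ x A C = trans (cong length (filter-++ (_≟ᶠ x) A C)) (length-++ (filter (_≟ᶠ x) A))

count-∉ : ∀ {x : Fin n} {L} → x ∉ L → count x L ≡ 0
count-∉ x∉L = cong length (filter-none (_≟ᶠ _) (All.map (λ x≢y y≡x → x≢y (sym y≡x)) (AllP.¬Any⇒All¬ _ x∉L)))

count-∈ : ∀ {x : Fin n} {L} → x ∈ L → 1 ≤ count x L
count-∈ x∈L = filter-some (_≟ᶠ _) (Any.map sym x∈L)

∈-count : ∀ (x : Fin n) L → 1 ≤ count x L → x ∈ L
∈-count x L pos with any? (x ≟ᶠ_) L
... | yes x∈L = x∈L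
... | no x∉L = contradiction (subst (1 ≤_) (count-∉ x∉L) pos) λ ()

count-≤-length : ∀ (x : Fin n) L → count x L ≤ length L
count-≤-length x = length-filter (_≟ᶠ x)

count-suffix : ∀ (x : Fin n) A C → count x C ≤ count x (A ++ C)
count-suffix x A C rewrite count-++ x A C = ℕP.m≤n+m (count x C) (count x A)

count-infix : ∀ (x : Fin n) A M C → count x M ≤ count x (A ++ M ++ C)
count-infix x A M C rewrite count-++ x A (M ++ C) | count-++ x M C =
  ℕP.≤-trans (ℕP.m≤m+n (count x M) (count x C)) (ℕP.m≤n+m _ (count x A))

count-block : ∀ (x : Fin n) pre C post → x ∉ pre → x ∉ post → count x (pre ++ C ++ post) ≡ count x C
count-block x pre C post x∉pre x∉post = begin
  count x (pre ++ C ++ post)         ≡⟨ count-++ x pre (C ++ post) ⟩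
  count x pre + count x (C ++ post)  ≡⟨ cong₂ _+_ (count-∉ x∉pre) (count-++ x C post) ⟩
  count x C + count x post           ≡⟨ cong (count x C +_) (count-∉ x∉post) ⟩
  count x C + 0                      ≡⟨ ℕP.+-identityʳ _ ⟩
  count x C                          ∎
  where open ≡-Reasoning

-- Parity of the number of moves.  After the moves L a vertex has been
-- flipped once per occurrence, so only the parity of its count matters.

odd : ℕ → Bool
odd zero = false
odd (suc k) = not (odd k)

run-++ : ∀ (τ : Config n) A C → run τ (A ++ C) ≡ run (run τ A) C
run-++ τ [] C = refl
run-++ τ (y ∷ A) C = run-++ (flip τ y) A C

run-parity : ∀ (τ : Config n) L x → run τ L x ≡ τ x xor odd (count x L)
run-parity τ [] x = sym (xor-identityʳ (τ x))
run-parity τ (y ∷ L) x with x ≟ᶠ y | run-parity (flip τ y) L x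
... | yes refl | ih = begin
  run (flip τ x) L x              ≡⟨ ih ⟩
  not (τ x) xor odd (count x L)   ≡⟨ sym (not-distribˡ-xor (τ x) _) ⟩
  not (τ x xor odd (count x L))   ≡⟨ not-distribʳ-xor (τ x) _ ⟩
  τ x xor odd (suc (count x L))   ≡⟨ cong (λ k → τ x xor odd k) (sym (count-self x L)) ⟩
  τ x xor odd (count x (x ∷ L))   ∎
  where open ≡-Reasoning
... | no x≢y | ih = trans ih (cong (λ k → τ x xor odd k) (sym (count-other L (λ y≡x → x≢y (sym y≡x)))))

-- Around a gap mid between two consecutive moves of v: the second move of v
-- undoes the first, every other vertex changes with the parity of its count.
run-gap-self : ∀ (σ : Config n) v mid → v ∉ mid → run σ (mid ++ [ v ]) v ≡ not (σ v)
run-gap-self σ v mid v∉mid = begin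
  run σ (mid ++ [ v ]) v                 ≡⟨ run-parity σ (mid ++ [ v ]) v ⟩
  σ v xor odd (count v (mid ++ [ v ]))   ≡⟨ cong (λ k → σ v xor odd k) count1 ⟩
  σ v xor true                           ≡⟨ sym (not-distribʳ-xor (σ v) false) ⟩
  not (σ v xor false)                    ≡⟨ cong not (xor-identityʳ (σ v)) ⟩
  not (σ v)                              ∎
  where
  open ≡-Reasoning
  count1 : count v (mid ++ [ v ]) ≡ 1
  count1 = trans (count-++ v mid [ v ]) (cong₂ _+_ (count-∉ v∉mid) (count-self v []))

run-gap-other : ∀ (σ : Config n) v mid w → w ≢ v → run σ (mid ++ [ v ]) w ≡ σ w xor odd (count w mid)
run-gap-other σ v mid w w≢v = begin
  run σ (mid ++ [ v ]) w                 ≡⟨ run-parity σ (mid ++ [ v ]) w ⟩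
  σ w xor odd (count w (mid ++ [ v ]))   ≡⟨ cong (λ k → σ w xor odd k) countMid ⟩
  σ w xor odd (count w mid)              ∎
  where
  open ≡-Reasoning
  countMid : count w (mid ++ [ v ]) ≡ count w mid
  countMid = trans (count-++ w mid [ v ])
    (trans (cong (λ k → count w mid + k) (count-other [] (λ v≡w → w≢v (sym v≡w)))) (ℕP.+-identityʳ _))

shift : ∀ (A : Seq n) {C : Seq n} → Fin (length C) → Fin (length (A ++ C))
shift [] i = i
shift (a ∷ A) i = Fin.suc (shift A i)

toℕ-shift : ∀ (A : Seq n) {C} (i : Fin (length C)) → toℕ (shift A {C} i) ≡ length A + toℕ i
toℕ-shift [] i = refl
toℕ-shift (a ∷ A) {C} i = cong suc (toℕ-shift A {C} i)

lookup-shift : ∀ (A : Seq n) {C} (i : Fin (length C)) → lookup (A ++ C) (shift A i) ≡ lookup C i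
lookup-shift [] i = refl
lookup-shift (a ∷ A) {C} i = lookup-shift A {C} i

take-shift : ∀ (A : Seq n) {C} (i : Fin (length C)) →
             take (suc (toℕ (shift A {C} i))) (A ++ C) ≡ A ++ take (suc (toℕ i)) C
take-shift [] i = refl
take-shift (a ∷ A) {C} i = cong (a ∷_) (take-shift A {C} i)

between : ∀ (A : Seq n) x M C (k : Fin (length (A ++ x ∷ M ++ x ∷ C))) →
          length A < toℕ k → toℕ k < length A + suc (length M) → lookup (A ++ x ∷ M ++ x ∷ C) k ∈ M
between (a ∷ A) x M C (Fin.suc k) (s≤s A<k) (s≤s k<) = between A x M C k A<k k<
between [] x M C (Fin.suc k) _ (s≤s k<) = inside M k k<
  where
  inside : ∀ M (k : Fin (length (M ++ x ∷ C))) → toℕ k < length M → lookup (M ++ x ∷ C) k ∈ M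
  inside (m ∷ M) Fin.zero _ = here refl
  inside (m ∷ M) (Fin.suc k) (s≤s k<) = there (inside M k k<)

record Gap (B : Seq n) : Set where
  constructor gap
  field
    pre : Seq n
    v : Fin n
    mid : Seq n
    post : Seq n
    split : pre ++ v ∷ mid ++ v ∷ post ≡ B
    v∉mid : v ∉ mid

gapPair : ∀ {B : Seq n} → Gap B → Pair B
gapPair (gap pre v mid post refl v∉mid) = (i , j) , i<j , trans lookup-i (sym lookup-j) , inMid
  where
  L : Seq _
  L = pre ++ v ∷ mid ++ v ∷ post
  i j : Fin (length L)
  i = shift pre Fin.zero
  j = shift pre (Fin.suc (shift mid Fin.zero))
  toℕ-i : toℕ i ≡ length pre
  toℕ-i = trans (toℕ-shift pre Fin.zero) (ℕP.+-identityʳ _)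
  toℕ-j : toℕ j ≡ length pre + suc (length mid)
  toℕ-j = trans (toℕ-shift pre _) (cong (λ k → length pre + suc k) (trans (toℕ-shift mid Fin.zero) (ℕP.+-identityʳ _)))
  lookup-i : lookup L i ≡ v
  lookup-i = lookup-shift pre Fin.zero
  lookup-j : lookup L j ≡ v
  lookup-j = trans (lookup-shift pre _) (lookup-shift mid Fin.zero)
  i<j : i Fin.< j
  i<j rewrite toℕ-i | toℕ-j = ℕP.m<m+n (length pre) z<s
  inMid : ∀ k → i Fin.< k → k Fin.< j → lookup L k ≢ lookup L i
  inMid k i<k k<j eq rewrite toℕ-i | toℕ-j | lookup-i =
    v∉mid (subst (_∈ mid) eq (between pre v mid post k i<k k<j))

-- Entries of M.  At a time where v has just moved, leaving configuration σ,
-- the row of an edge {a,b} holds ±1 if v ∈ {a,b} (−1 when a and b agree) and 0 otherwise.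

sign : Bool → ℤ
sign agree = if agree then ℤ.-[1+ 0 ] else ℤ.+ 1

stepEntry : Fin n → Config n → Fin n → Fin n → ℤ
stepEntry v σ a b = if does (v ≟ᶠ a) ∨ does (v ≟ᶠ b) then sign (does (σ a ≟ᵇ σ b)) else ℤ.+ 0

≟ᵇ-sym : ∀ x y → does (x ≟ᵇ y) ≡ does (y ≟ᵇ x)
≟ᵇ-sym true true = refl
≟ᵇ-sym true false = refl
≟ᵇ-sym false true = refl
≟ᵇ-sym false false = refl

stepEntry-sym : ∀ (v : Fin n) σ a b → stepEntry v σ a b ≡ stepEntry v σ b a
stepEntry-sym v σ a b =
  cong₂ (λ at-v agree → if at-v then sign agree else ℤ.+ 0) (∨-comm (does (v ≟ᶠ a)) _) (≟ᵇ-sym (σ a) (σ b))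

stepEntry-off : ∀ {v : Fin n} σ {a b} → v ≢ a → v ≢ b → stepEntry v σ a b ≡ ℤ.+ 0
stepEntry-off {v = v} σ {a} {b} v≢a v≢b rewrite dec-false (v ≟ᶠ a) v≢a | dec-false (v ≟ᶠ b) v≢b = refl

stepEntry-on : ∀ (v : Fin n) σ b → stepEntry v σ v b ≡ sign (does (σ v ≟ᵇ σ b))
stepEntry-on v σ b rewrite dec-true (v ≟ᶠ v) refl = refl

-- The column of a gap: by the parity lemmas, the two entries of an edge {v,w}
-- cancel exactly when w moves an even number of times inside the gap.
gapSum-even : ∀ a b → sign (does (a ≟ᵇ b)) ℤ.+ sign (does (not a ≟ᵇ (b xor false))) ≡ ℤ.+ 0
gapSum-even true true = refl
gapSum-even true false = refl
gapSum-even false true = refl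
gapSum-even false false = refl

gapSum-odd : ∀ a b → sign (does (a ≟ᵇ b)) ℤ.+ sign (does (not a ≟ᵇ (b xor true))) ≢ ℤ.+ 0
gapSum-odd true true ()
gapSum-odd true false ()
gapSum-odd false true ()
gapSum-odd false false ()

edge : (x y : Fin n) → x ≢ y → Edge n
edge x y x≢y with FinP.<-cmp x y
... | tri< x<y _ _ = (x , y) , x<y
... | tri≈ _ x≡y _ = contradiction x≡y x≢y
... | tri> _ _ y<x = (y , x) , y<x

before after : ∀ {B : Seq n} → Config n → Gap B → Config n
before τ₀ g = run τ₀ (Gap.pre g ++ [ Gap.v g ])
after τ₀ g = run (before τ₀ g) (Gap.mid g ++ [ Gap.v g ])

P-gapEnds : ∀ {B : Seq n} τ₀ (g : Gap B) a b (a<b : a Fin.< b) →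
            P B τ₀ ((a , b) , a<b) (gapPair g) ≡ stepEntry (Gap.v g) (before τ₀ g) a b ℤ.+ stepEntry (Gap.v g) (after τ₀ g) a b
P-gapEnds τ₀ g@(gap pre v mid post refl v∉mid) a b a<b = cong₂ ℤ._+_
  (cong₂ (λ u σ → stepEntry u σ a b) (lookup-shift pre Fin.zero) (cong (run τ₀) (take-shift pre Fin.zero)))
  (cong₂ (λ u σ → stepEntry u σ a b) (trans (lookup-shift pre _) (lookup-shift mid Fin.zero)) τ-after)
  where
  open ≡-Reasoning
  τ-after : τAt (pre ++ v ∷ mid ++ v ∷ post) τ₀ (shift pre (Fin.suc (shift mid Fin.zero))) ≡ after τ₀ g
  τ-after = begin
    run τ₀ (take (suc (toℕ (shift pre (Fin.suc (shift mid Fin.zero))))) (pre ++ v ∷ mid ++ v ∷ post))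
      ≡⟨ cong (run τ₀) (trans (take-shift pre _) (cong (λ t → pre ++ v ∷ t) (take-shift mid Fin.zero))) ⟩
    run τ₀ (pre ++ v ∷ mid ++ [ v ])      ≡⟨ cong (run τ₀) (sym (++-assoc pre [ v ] (mid ++ [ v ]))) ⟩
    run τ₀ ((pre ++ [ v ]) ++ mid ++ [ v ]) ≡⟨ run-++ τ₀ (pre ++ [ v ]) (mid ++ [ v ]) ⟩
    after τ₀ g                           ∎

P-gap : ∀ {B : Seq n} τ₀ (g : Gap B) x y (x≢y : x ≢ y) →
        P B τ₀ (edge x y x≢y) (gapPair g) ≡ stepEntry (Gap.v g) (before τ₀ g) x y ℤ.+ stepEntry (Gap.v g) (after τ₀ g) x y
P-gap τ₀ g x y x≢y with FinP.<-cmp x y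
... | tri< x<y _ _ = P-gapEnds τ₀ g x y x<y
... | tri≈ _ x≡y _ = contradiction x≡y x≢y
... | tri> _ _ y<x = trans (P-gapEnds τ₀ g y x y<x)
  (cong₂ ℤ._+_ (stepEntry-sym (Gap.v g) (before τ₀ g) y x) (stepEntry-sym (Gap.v g) (after τ₀ g) y x))

P-gap-off : ∀ {B : Seq n} τ₀ (g : Gap B) x y (x≢y : x ≢ y) → Gap.v g ≢ x → Gap.v g ≢ y →
            P B τ₀ (edge x y x≢y) (gapPair g) ≡ ℤ.+ 0
P-gap-off τ₀ g x y x≢y v≢x v≢y =
  trans (P-gap τ₀ g x y x≢y) (cong₂ ℤ._+_ (stepEntry-off (before τ₀ g) v≢x v≢y) (stepEntry-off (after τ₀ g) v≢x v≢y))

P-gap-at : ∀ {B : Seq n} τ₀ (g : Gap B) w (v≢w : Gap.v g ≢ w) →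
           P B τ₀ (edge (Gap.v g) w v≢w) (gapPair g) ≡
           sign (does (before τ₀ g (Gap.v g) ≟ᵇ before τ₀ g w)) ℤ.+
           sign (does (not (before τ₀ g (Gap.v g)) ≟ᵇ (before τ₀ g w xor odd (count w (Gap.mid g)))))
P-gap-at {B = B} τ₀ g w v≢w = begin
  P B τ₀ (edge v w v≢w) (gapPair g)
    ≡⟨ P-gap τ₀ g v w v≢w ⟩
  stepEntry v σ v w ℤ.+ stepEntry v σ' v w
    ≡⟨ cong₂ ℤ._+_ (stepEntry-on v σ w) (stepEntry-on v σ' w) ⟩
  sign (does (σ v ≟ᵇ σ w)) ℤ.+ sign (does (σ' v ≟ᵇ σ' w))
    ≡⟨ cong₂ (λ x y → sign (does (σ v ≟ᵇ σ w)) ℤ.+ sign (does (x ≟ᵇ y)))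
         (run-gap-self σ v mid v∉mid) (run-gap-other σ v mid w (λ w≡v → v≢w (sym w≡v))) ⟩
  sign (does (σ v ≟ᵇ σ w)) ℤ.+ sign (does (not (σ v) ≟ᵇ (σ w xor odd (count w mid)))) ∎
  where
  open ≡-Reasoning
  open Gap g
  σ σ' : Config _
  σ = before τ₀ g
  σ' = after τ₀ g

P-gap-even : ∀ {B : Seq n} τ₀ (g : Gap B) w (v≢w : Gap.v g ≢ w) → odd (count w (Gap.mid g)) ≡ false →
             P B τ₀ (edge (Gap.v g) w v≢w) (gapPair g) ≡ ℤ.+ 0
P-gap-even τ₀ g w v≢w even rewrite P-gap-at τ₀ g w v≢w | even = gapSum-even (before τ₀ g (Gap.v g)) (before τ₀ g w)

P-gap-odd : ∀ {B : Seq n} τ₀ (g : Gap B) w (v≢w : Gap.v g ≢ w) → odd (count w (Gap.mid g)) ≡ true →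
            P B τ₀ (edge (Gap.v g) w v≢w) (gapPair g) ≢ ℤ.+ 0
P-gap-odd τ₀ g w v≢w isOdd rewrite P-gap-at τ₀ g w v≢w | isOdd = gapSum-odd (before τ₀ g (Gap.v g)) (before τ₀ g w)

ℤ/1≢0 : ∀ z → z ≢ ℤ.+ 0 → (z ℚ./ 1) ≢ 0ℚ
ℤ/1≢0 z z≢0 z/1≡0 = z≢0 (begin
  z                                 ≡⟨ sym (ℚP.↥-/ z 1) ⟩
  ↥ (z ℚ./ 1) ℤ.* gcd z (ℤ.+ 1)     ≡⟨ cong (λ q → ↥ q ℤ.* gcd z (ℤ.+ 1)) z/1≡0 ⟩
  ℤ.+ 0 ℤ.* gcd z (ℤ.+ 1)             ≡⟨ ℤP.*-zeroˡ (gcd z (ℤ.+ 1)) ⟩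
  ℤ.+ 0                             ∎)
  where open ≡-Reasoning

*-cancelʳ-0 : ∀ c q → q ≢ 0ℚ → c ℚ.* q ≡ 0ℚ → c ≡ 0ℚ
*-cancelʳ-0 c q q≢0 cq≡0 = begin
  c                          ≡⟨ sym (ℚP.*-identityʳ c) ⟩
  c ℚ.* 1ℚ                   ≡⟨ cong (c ℚ.*_) (sym (ℚP.*-inverseʳ q)) ⟩
  c ℚ.* (q ℚ.* ℚ.1/ q)       ≡⟨ sym (ℚP.*-assoc c q _) ⟩
  (c ℚ.* q) ℚ.* ℚ.1/ q       ≡⟨ cong (ℚ._* _) cq≡0 ⟩
  0ℚ ℚ.* ℚ.1/ q              ≡⟨ ℚP.*-zeroˡ (ℚ.1/ q) ⟩
  0ℚ                         ∎
  where
  open ≡-Reasoning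
  instance _ = ℚ.≢-nonZero q≢0

sumℚ-zero : ∀ k (f : Fin k → ℚ) → (∀ i → f i ≡ 0ℚ) → sumℚ k f ≡ 0ℚ
sumℚ-zero zero f f≡0 = refl
sumℚ-zero (suc k) f f≡0 rewrite f≡0 Fin.zero | sumℚ-zero k (λ i → f (Fin.suc i)) (λ i → f≡0 (Fin.suc i)) = refl

module _ {R C : Set} (A : R → C → ℤ) where

  Triangular : List (R × C) → Set
  Triangular fam = All (λ (r , c) → A r c ≢ ℤ.+ 0) fam × AllPairs (λ (r , _) (_ , c) → A r c ≡ ℤ.+ 0) fam

  columns : (fam : List (R × C)) → Fin (length fam) → C
  columns fam i = proj₂ (lookup fam i)

  triangular⇒independent : ∀ fam → Triangular fam → LinIndepCols A (length fam) (columns fam)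
  triangular⇒independent ((r , c) ∷ fam) (diag ∷ diags , below ∷ belows) coef combo = coef≡0
    where
    term : R → Fin (length fam) → ℚ
    term row i = coef (Fin.suc i) ℚ.* (A row (columns fam i) ℚ./ 1)

    rest-vanishes : ∀ i → term r i ≡ 0ℚ
    rest-vanishes i = trans (cong (λ z → coef (Fin.suc i) ℚ.* (z ℚ./ 1)) (All.lookup below (∈-lookup i)))
                            (ℚP.*-zeroʳ (coef (Fin.suc i)))

    head≡0 : coef Fin.zero ≡ 0ℚ
    head≡0 = *-cancelʳ-0 (coef Fin.zero) _ (ℤ/1≢0 (A r c) diag) (begin
      coef Fin.zero ℚ.* (A r c ℚ./ 1)
        ≡⟨ sym (ℚP.+-identityʳ _) ⟩
      coef Fin.zero ℚ.* (A r c ℚ./ 1) ℚ.+ 0ℚ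
        ≡⟨ cong (coef Fin.zero ℚ.* (A r c ℚ./ 1) ℚ.+_) (sym (sumℚ-zero _ (term r) rest-vanishes)) ⟩
      coef Fin.zero ℚ.* (A r c ℚ./ 1) ℚ.+ sumℚ (length fam) (term r)
        ≡⟨ combo r ⟩
      0ℚ ∎)
      where open ≡-Reasoning

    -- with the head coefficient gone, the tail is a vanishing combination of the tail family
    tail-combo : ∀ row → sumℚ (length fam) (term row) ≡ 0ℚ
    tail-combo row = begin
      sumℚ (length fam) (term row)
        ≡⟨ sym (ℚP.+-identityˡ _) ⟩
      0ℚ ℚ.+ sumℚ (length fam) (term row)
        ≡⟨ cong (ℚ._+ sumℚ (length fam) (term row)) (sym (ℚP.*-zeroˡ (A row c ℚ./ 1))) ⟩
      0ℚ ℚ.* (A row c ℚ./ 1) ℚ.+ sumℚ (length fam) (term row)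
        ≡⟨ cong (λ q → q ℚ.* (A row c ℚ./ 1) ℚ.+ sumℚ (length fam) (term row)) (sym head≡0) ⟩
      coef Fin.zero ℚ.* (A row c ℚ./ 1) ℚ.+ sumℚ (length fam) (term row)
        ≡⟨ combo row ⟩
      0ℚ ∎
      where open ≡-Reasoning

    coef≡0 : ∀ i → coef i ≡ 0ℚ
    coef≡0 Fin.zero = head≡0
    coef≡0 (Fin.suc i) = triangular⇒independent fam (diags , belows) (λ i → coef (Fin.suc i)) tail-combo i

  triangular⇒rank : ∀ fam → Triangular fam → RankAtLeast A (length fam)
  triangular⇒rank fam tri = columns fam , triangular⇒independent fam tri

  rank-⊔ : ∀ {a b} → RankAtLeast A a → RankAtLeast A b → RankAtLeast A (a ℕ.⊔ b)
  rank-⊔ {a} {b} rank-a rank-b with ℕP.⊔-sel a b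
  ... | inj₁ a⊔b≡a = subst (RankAtLeast A) (sym a⊔b≡a) rank-a
  ... | inj₂ a⊔b≡b = subst (RankAtLeast A) (sym a⊔b≡b) rank-b

-- Witnesses.  A gap of v together with a vertex w ≠ v that moves an odd number of
-- times inside it; by P-gap-odd its column is nonzero in the row of the edge {v,w}.

record Witness (B : Seq n) : Set where
  constructor witness
  field
    g : Gap B
    w : Fin n
    v≢w : Gap.v g ≢ w
    w-odd : odd (count w (Gap.mid g)) ≡ true

  open Gap g public using (v; mid)

  row : Edge n
  row = edge v w v≢w

  column : Pair B
  column = gapPair g

module _ {B : Seq n} where

  open Witness

  -- the column of y vanishes in the row of x (P-gap-off, resp. P-gap-even)
  Clears : Witness B → Witness B → Set
  Clears x y = (v y ≢ v x × v y ≢ w x) ⊎ (v y ≡ v x × odd (count (w x) (mid y)) ≡ false)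

  clears⇒zero : ∀ τ₀ x y → Clears x y → P B τ₀ (row x) (column y) ≡ ℤ.+ 0
  clears⇒zero τ₀ x y (inj₁ (vy≢vx , vy≢wx)) = P-gap-off τ₀ (g y) (v x) (w x) (v≢w x) vy≢vx vy≢wx
  clears⇒zero τ₀ x y (inj₂ (vy≡vx , even)) = atVertex (g y) (v≢w x) vy≡vx even
    where
    atVertex : ∀ (gy : Gap B) (vx≢wx : v x ≢ w x) → Gap.v gy ≡ v x → odd (count (w x) (Gap.mid gy)) ≡ false →
               P B τ₀ (edge (v x) (w x) vx≢wx) (gapPair gy) ≡ ℤ.+ 0
    atVertex gy vx≢wx refl even = P-gap-even τ₀ gy (w x) vx≢wx even

  witnesses⇒rank : ∀ τ₀ (fam : List (Witness B)) → AllPairs Clears fam → RankAtLeast (P B τ₀) (length fam)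
  witnesses⇒rank τ₀ fam clears =
    subst (RankAtLeast (P B τ₀)) (length-map entry fam) (triangular⇒rank (P B τ₀) (map entry fam) (diagonal , below))
    where
    entry : Witness B → Edge n × Pair B
    entry e = row e , column e
    diagonal : All (λ (r , c) → P B τ₀ r c ≢ ℤ.+ 0) (map entry fam)
    diagonal = AllP.map⁺ (All.tabulate (λ {e} _ → P-gap-odd τ₀ (g e) (w e) (v≢w e) (w-odd e)))
    below : AllPairs (λ (r , _) (_ , c) → P B τ₀ r c ≡ ℤ.+ 0) (map entry fam)
    below = AllPairsP.map⁺ (AllPairs.map (λ {x} {y} → clears⇒zero τ₀ x y) clears)

𝟙 : Bool → ℕ
𝟙 b = if b then 1 else 0

occurs : Fin n → Seq n → Bool
occurs x L = does (any? (x ≟ᶠ_) L)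

∑-zero : ∀ m → ∑ {m} (λ _ → 0) ≡ 0
∑-zero zero = refl
∑-zero (suc m) = ∑-zero m

∑-mono : ∀ {m} (f h : Fin m → ℕ) → (∀ i → f i ≤ h i) → ∑ f ≤ ∑ h
∑-mono {zero} f h f≤h = z≤n
∑-mono {suc m} f h f≤h = ℕP.+-mono-≤ (f≤h Fin.zero) (∑-mono (f ∘ Fin.suc) (h ∘ Fin.suc) (f≤h ∘ Fin.suc))

∑-at : ∀ {m} (c : Fin m) (f : Fin m → ℕ) → ∑ (λ x → if does (c ≟ᶠ x) then f x else 0) ≡ f c
∑-at {suc m} Fin.zero f = trans (cong (f Fin.zero +_) (∑-zero m)) (ℕP.+-identityʳ _)
∑-at {suc m} (Fin.suc c) f = ∑-at c (f ∘ Fin.suc)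

#[_] : (Fin n → Bool) → ℕ
#[ p ] = ∑ (λ x → 𝟙 (p x))

_∖_ : (Fin n → Bool) → Fin n → Fin n → Bool
(T ∖ u) x = T x ∧ not (does (x ≟ᶠ u))

∖-true : ∀ (T : Fin n → Bool) {u x} → (T ∖ u) x ≡ true → T x ≡ true × x ≢ u
∖-true T {u} {x} eq with T x | x ≟ᶠ u
... | true | no x≢u = refl , x≢u
... | true | yes _ = contradiction eq λ ()
... | false | _ = contradiction eq λ ()

#-remove : ∀ (p : Fin n → Bool) x → p x ≡ true → #[ p ] ≡ suc #[ p ∖ x ]
#-remove p x px = begin
  #[ p ]                                                    ≡⟨ sum-cong-≗ pointwise ⟩
  ∑ (λ y → 𝟙 ((p ∖ x) y) + (if does (x ≟ᶠ y) then 1 else 0)) ≡⟨ ∑-distrib-+ (λ y → 𝟙 ((p ∖ x) y)) _ ⟩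
  #[ p ∖ x ] + ∑ (λ y → if does (x ≟ᶠ y) then 1 else 0)      ≡⟨ cong (#[ p ∖ x ] +_) (∑-at x (λ _ → 1)) ⟩
  #[ p ∖ x ] + 1                                            ≡⟨ ℕP.+-comm _ 1 ⟩
  suc #[ p ∖ x ]                                            ∎
  where
  open ≡-Reasoning
  pointwise : ∀ y → 𝟙 (p y) ≡ 𝟙 ((p ∖ x) y) + (if does (x ≟ᶠ y) then 1 else 0)
  pointwise y with y ≟ᶠ x | x ≟ᶠ y
  ... | yes refl | yes _ rewrite px = refl
  ... | yes refl | no x≢x = contradiction refl x≢x
  ... | no y≢x | yes refl = contradiction refl y≢x
  ... | no _ | no _ = sym (trans (ℕP.+-identityʳ _) (cong 𝟙 (∧-identityʳ (p y))))

#-nonempty : ∀ (p : Fin n → Bool) → 0 < #[ p ] → Σ (Fin n) λ x → p x ≡ true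
#-nonempty {n} p pos with FinP.any? (λ x → p x ≟ᵇ true)
... | yes member = member
... | no none = contradiction (subst (0 <_) (trans (sum-cong-≗ absent) (∑-zero n)) pos) λ ()
  where
  absent : ∀ x → 𝟙 (p x) ≡ 0
  absent x with p x in px
  ... | true = contradiction (x , px) none
  ... | false = refl

filter-allFin : ∀ {p} {P : Pred (Fin n) p} (P? : Decidable P) →
                length (filter P? (allFin n)) ≡ ∑ (λ x → 𝟙 (does (P? x)))
filter-allFin {n} P? = filterTab n (λ x → x)
  where
  filterTab : ∀ m (f : Fin m → Fin n) → length (filter P? (tabulate f)) ≡ ∑ (λ i → 𝟙 (does (P? (f i))))
  filterTab zero f = refl
  filterTab (suc m) f with does (P? (f Fin.zero))
  ... | true = cong suc (filterTab m (f ∘ Fin.suc))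
  ... | false = filterTab m (f ∘ Fin.suc)

s-as-sum : ∀ (L : Seq n) → s L ≡ ∑ (λ x → 𝟙 (occurs x L))
s-as-sum L = filter-allFin (λ x → any? (x ≟ᶠ_) L)

length-filter-as-sum : ∀ {p} {P : Pred (Fin n) p} (P? : Decidable P) (L : Seq n) →
                       length (filter P? L) ≡ ∑ (λ x → if does (P? x) then count x L else 0)
length-filter-as-sum {n} P? [] = sym (trans (sum-cong-≗ nothing) (∑-zero n))
  where
  nothing : ∀ x → (if does (P? x) then 0 else 0) ≡ 0
  nothing x with does (P? x)
  ... | true = refl
  ... | false = refl
length-filter-as-sum P? (c ∷ L) = begin
  length (filter P? (c ∷ L))                                 ≡⟨ length-filter-∷ ⟩
  length (filter P? L) + 𝟙 (does (P? c))
    ≡⟨ cong₂ _+_ (length-filter-as-sum P? L) (sym (∑-at c (λ x → 𝟙 (does (P? x))))) ⟩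
  ∑ (λ x → if does (P? x) then count x L else 0) + ∑ (λ x → if does (c ≟ᶠ x) then 𝟙 (does (P? x)) else 0)
    ≡⟨ sym (∑-distrib-+ (λ x → if does (P? x) then count x L else 0) _) ⟩
  ∑ (λ x → (if does (P? x) then count x L else 0) + (if does (c ≟ᶠ x) then 𝟙 (does (P? x)) else 0))
    ≡⟨ sum-cong-≗ pointwise ⟩
  ∑ (λ x → if does (P? x) then count x (c ∷ L) else 0)     ∎
  where
  open ≡-Reasoning
  length-filter-∷ : length (filter P? (c ∷ L)) ≡ length (filter P? L) + 𝟙 (does (P? c))
  length-filter-∷ with does (P? c)
  ... | true = ℕP.+-comm 1 _
  ... | false = sym (ℕP.+-identityʳ _)
  pointwise : ∀ x → (if does (P? x) then count x L else 0) + (if does (c ≟ᶠ x) then 𝟙 (does (P? x)) else 0) ≡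
                    (if does (P? x) then count x (c ∷ L) else 0)
  pointwise x rewrite count-∷ c L x with does (P? x) | does (c ≟ᶠ x)
  ... | true | _ = refl
  ... | false | true = refl
  ... | false | false = refl

length-as-sum : ∀ (L : Seq n) → length L ≡ ∑ (λ x → count x L)
length-as-sum L = trans (cong length (sym (filter-all every {L} (All.tabulate (λ _ → tt))))) (length-filter-as-sum every L)
  where
  every : Decidable {A = Fin _} (λ _ → ⊤)
  every _ = yes tt

dense : ∀ (C : Seq n) → (∀ y → y ∈ C → 2 ≤ count y C) → 2 * s C ≤ length C
dense C twice = begin
  2 * s C                                            ≡⟨ cong (λ k → k + (k + 0)) (s-as-sum C) ⟩
  ∑ (λ x → 𝟙 (occurs x C)) + (∑ (λ x → 𝟙 (occurs x C)) + 0)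
    ≡⟨ cong (∑ (λ x → 𝟙 (occurs x C)) +_) (ℕP.+-identityʳ _) ⟩
  ∑ (λ x → 𝟙 (occurs x C)) + ∑ (λ x → 𝟙 (occurs x C)) ≡⟨ sym (∑-distrib-+ (λ x → 𝟙 (occurs x C)) _) ⟩
  ∑ (λ x → 𝟙 (occurs x C) + 𝟙 (occurs x C))         ≤⟨ ∑-mono _ _ twiceEach ⟩
  ∑ (λ x → count x C)                               ≡⟨ sym (length-as-sum C) ⟩
  length C                                           ∎
  where
  open ℕP.≤-Reasoning
  twiceEach : ∀ x → 𝟙 (occurs x C) + 𝟙 (occurs x C) ≤ count x C
  twiceEach x with any? (x ≟ᶠ_) C
  ... | yes x∈C = twice x x∈C
  ... | no _ = z≤n

firstOcc : ∀ (x : Fin n) L → x ∈ L → Σ (Seq n) λ mid → Σ (Seq n) λ post → L ≡ mid ++ x ∷ post × x ∉ mid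
firstOcc x (y ∷ L) x∈ with x ≟ᶠ y
... | yes refl = [] , L , refl , λ ()
firstOcc x (y ∷ L) (here x≡y) | no x≢y = contradiction x≡y x≢y
firstOcc x (y ∷ L) (there x∈L) | no x≢y with firstOcc x L x∈L
... | mid , post , refl , x∉mid = y ∷ mid , post , refl , λ { (here x≡y) → x≢y x≡y ; (there x∈mid) → x∉mid x∈mid }

lastOcc : ∀ (x : Fin n) L → x ∈ L → Σ (Seq n) λ pre → Σ (Seq n) λ suf → L ≡ pre ++ x ∷ suf × x ∉ suf
lastOcc x (y ∷ L) x∈ with any? (x ≟ᶠ_) L
... | yes x∈L with lastOcc x L x∈L
...   | pre , suf , refl , x∉suf = y ∷ pre , suf , refl , x∉suf
lastOcc x (y ∷ L) (here refl) | no x∉L = [] , L , refl , x∉L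
lastOcc x (y ∷ L) (there x∈L) | no x∉L = contradiction x∈L x∉L

first-unique : ∀ (x : Fin n) mid post mid′ post′ →
               mid ++ x ∷ post ≡ mid′ ++ x ∷ post′ → x ∉ mid → x ∉ mid′ → mid ≡ mid′
first-unique x [] post [] post′ eq _ _ = refl
first-unique x [] post (m ∷ mid′) post′ eq _ x∉mid′ = contradiction (here (proj₁ (∷-injective eq))) x∉mid′
first-unique x (m ∷ mid) post [] post′ eq x∉mid _ = contradiction (here (sym (proj₁ (∷-injective eq)))) x∉mid
first-unique x (m ∷ mid) post (m′ ∷ mid′) post′ eq x∉mid x∉mid′ with ∷-injective eq
... | refl , eq′ =
  cong (m ∷_) (first-unique x mid post mid′ post′ eq′ (λ x∈ → x∉mid (there x∈)) (λ x∈ → x∉mid′ (there x∈)))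

searchSplits : ∀ {A : Set} {Good Bad : List A → A → List A → Set} →
               (∀ xs y ys → Good xs y ys ⊎ Bad xs y ys) → ∀ L →
               (∀ xs y ys → xs ++ y ∷ ys ≡ L → Good xs y ys) ⊎
               Σ (List A) λ xs → Σ A λ y → Σ (List A) λ ys → xs ++ y ∷ ys ≡ L × Bad xs y ys
searchSplits decide [] = inj₁ λ { [] _ _ () ; (_ ∷ _) _ _ () }
searchSplits {Good = Good} decide (z ∷ L) with decide [] z L
... | inj₂ bad = inj₂ ([] , z , L , refl , bad)
... | inj₁ good with searchSplits (λ xs → decide (z ∷ xs)) L
...   | inj₂ (xs , y , ys , refl , bad) = inj₂ (z ∷ xs , y , ys , refl , bad)
...   | inj₁ allGood = inj₁ goodAt
  where
  goodAt : ∀ xs y ys → xs ++ y ∷ ys ≡ z ∷ L → Good xs y ys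
  goodAt [] y ys eq with ∷-injective eq
  ... | refl , refl = good
  goodAt (x ∷ xs) y ys eq with ∷-injective eq
  ... | refl , eq′ = allGood xs y ys eq′

module _ (B : Seq n) {Q : Fin n → Seq n → Set} (Q? : ∀ v mid → Dec (Q v mid)) where

  NoGapAt GapAt : Seq n → Fin n → Seq n → Set
  NoGapAt pre y rest = ∀ mid post → rest ≡ mid ++ y ∷ post → y ∉ mid → ¬ Q y mid
  GapAt pre y rest = Σ (Seq n) λ mid → Σ (Seq n) λ post → rest ≡ mid ++ y ∷ post × y ∉ mid × Q y mid

  gapAt? : ∀ pre y rest → NoGapAt pre y rest ⊎ GapAt pre y rest
  gapAt? pre y rest with any? (y ≟ᶠ_) rest
  ... | no y∉rest = inj₁ λ { mid post refl _ _ → y∉rest (∈-++⁺ʳ mid (here refl)) }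
  ... | yes y∈rest with firstOcc y rest y∈rest
  ...   | mid₀ , post₀ , refl , y∉mid₀ with Q? y mid₀
  ...     | yes q = inj₂ (mid₀ , post₀ , refl , y∉mid₀ , q)
  ...     | no ¬q = inj₁ λ mid post eq y∉mid →
              subst (λ m → ¬ Q y m) (first-unique y mid₀ post₀ mid post eq y∉mid₀ y∉mid) ¬q

  searchGaps : Σ (Gap B) (λ g → Q (Gap.v g) (Gap.mid g)) ⊎ (∀ (g : Gap B) → ¬ Q (Gap.v g) (Gap.mid g))
  searchGaps with searchSplits gapAt? B
  ... | inj₂ (pre , v , rest , split , (mid , post , refl , v∉mid , q)) = inj₁ (gap pre v mid post split v∉mid , q)
  ... | inj₁ noGap = inj₂ λ (gap pre v mid post split v∉mid) → noGap pre v (mid ++ v ∷ post) split mid post refl v∉mid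

even⇒≥2 : ∀ k → odd k ≡ false → 1 ≤ k → 2 ≤ k
even⇒≥2 (suc zero) () _
even⇒≥2 (suc (suc k)) _ _ = s≤s (s≤s z≤n)

DenseBlock : Seq n → Set
DenseBlock {n} B = Σ (Seq n) λ pre → Σ (Seq n) λ C → Σ (Seq n) λ post →
                   pre ++ C ++ post ≡ B × 0 < length C × (∀ y → y ∈ C → 2 ≤ count y C)

-- If T is stuck (no gap of a
-- T-vertex contains a vertex outside T an odd number of times), cut B at positions that no
-- T-vertex straddles until every position is straddled; the resulting block is dense.
module Connectivity {B : Seq n} (T : Fin n → Bool) where

  open import Algebra.Solver.Monoid (++-monoid (Fin n)) using (_⊜_; _⊕_) renaming (solve to ++-solve)

  Stuck : Set
  Stuck = ∀ (g : Gap B) → T (Gap.v g) ≡ true → ∀ w → T w ≡ false → odd (count w (Gap.mid g)) ≡ false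

  Repeated : Set
  Repeated = ∀ x → T x ≡ true → 2 ≤ count x B

  record Enclosing (C : Seq n) : Set where
    constructor enclosing
    field
      pre post : Seq n
      split : pre ++ C ++ post ≡ B
      someT : Σ (Fin n) λ x → T x ≡ true × x ∈ C
      closed : ∀ x → T x ≡ true → x ∈ C → x ∉ pre × x ∉ post

  Straddled : Seq n → Set
  Straddled C = ∀ A y D → A ++ y ∷ D ≡ C → T y ≡ false → Σ (Fin n) λ x → T x ≡ true × x ∈ A × x ∈ D

  -- If T is stuck, a straddled enclosing block is dense: a T-vertex keeps all its
  -- occurrences in C, and any other vertex y lies inside a gap of a T-vertex,
  -- which contains y an even, hence at least twice, number of times.
  straddled⇒dense : Stuck → Repeated → ∀ {C} → Enclosing C → Straddled C → ∀ y → y ∈ C → 2 ≤ count y C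
  straddled⇒dense stuck repeated (enclosing pre post split _ closed) straddled y y∈C with ∈-∃++ y∈C
  ... | A , D , refl with T y in Ty
  ...   | true = subst (2 ≤_) (trans (cong (count y) (sym split)) (count-block y pre _ post y∉pre y∉post)) (repeated y Ty)
    where
    y∉pre : y ∉ pre
    y∉pre = proj₁ (closed y Ty y∈C)
    y∉post : y ∉ post
    y∉post = proj₂ (closed y Ty y∈C)
  ...   | false with straddled A y D refl Ty
  ...     | x , Tx , x∈A , x∈D with lastOcc x A x∈A | firstOcc x D x∈D
  ...       | A₁ , A₂ , refl , x∉A₂ | D₁ , D₂ , refl , x∉D₁ =
    ℕP.≤-trans (even⇒≥2 _ (stuck g Tx y Ty) (count-∈ (∈-++⁺ʳ A₂ (here refl)))) inC
    where
    mid : Seq n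
    mid = A₂ ++ y ∷ D₁
    x∉mid : x ∉ mid
    x∉mid x∈mid with ∈-++⁻ A₂ x∈mid
    ... | inj₁ x∈A₂ = x∉A₂ x∈A₂
    ... | inj₂ (here refl) = contradiction (trans (sym Tx) Ty) λ ()
    ... | inj₂ (there x∈D₁) = x∉D₁ x∈D₁
    g : Gap B
    g = gap (pre ++ A₁) x mid (D₂ ++ post) (trans regroup split) x∉mid
      where
      regroup : (pre ++ A₁) ++ x ∷ mid ++ x ∷ (D₂ ++ post) ≡ pre ++ ((A₁ ++ x ∷ A₂) ++ y ∷ (D₁ ++ x ∷ D₂)) ++ post
      regroup = ++-solve 8 (λ p a₁ x a₂ y d₁ d₂ q →
        (p ⊕ a₁) ⊕ x ⊕ (a₂ ⊕ y ⊕ d₁) ⊕ x ⊕ (d₂ ⊕ q) ⊜ p ⊕ ((a₁ ⊕ x ⊕ a₂) ⊕ y ⊕ (d₁ ⊕ x ⊕ d₂)) ⊕ q) refl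
        pre A₁ [ x ] A₂ [ y ] D₁ D₂ post
    inC : count y mid ≤ count y ((A₁ ++ x ∷ A₂) ++ y ∷ (D₁ ++ x ∷ D₂))
    inC = subst (λ C → count y mid ≤ count y C) regroup (count-infix y (A₁ ++ [ x ]) mid (x ∷ D₂))
      where
      regroup : (A₁ ++ [ x ]) ++ mid ++ x ∷ D₂ ≡ (A₁ ++ x ∷ A₂) ++ y ∷ (D₁ ++ x ∷ D₂)
      regroup = ++-solve 6 (λ a₁ x a₂ y d₁ d₂ →
        (a₁ ⊕ x) ⊕ (a₂ ⊕ y ⊕ d₁) ⊕ x ⊕ d₂ ⊜ (a₁ ⊕ x ⊕ a₂) ⊕ y ⊕ (d₁ ⊕ x ⊕ d₂)) refl
        A₁ [ x ] A₂ [ y ] D₁ D₂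

  Apart : Seq n → Fin n → Seq n → Set
  Apart A y D = T y ≡ false × (∀ x → T x ≡ true → x ∈ A → x ∉ D)

  straddled? : ∀ A y D → (T y ≡ false → Σ (Fin n) λ x → T x ≡ true × x ∈ A × x ∈ D) ⊎ Apart A y D
  straddled? A y D with T y
  ... | true = inj₁ λ ()
  ... | false with FinP.any? (λ x → (T x ≟ᵇ true) ×-dec any? (x ≟ᶠ_) A ×-dec any? (x ≟ᶠ_) D)
  ...   | yes (x , Tx , x∈A , x∈D) = inj₁ λ _ → x , Tx , x∈A , x∈D
  ...   | no none = inj₂ (refl , λ x Tx x∈A x∈D → none (x , Tx , x∈A , x∈D))

  enclosing-before : ∀ A y D → Enclosing (A ++ y ∷ D) → Apart A y D → Σ (Fin n) (λ x → T x ≡ true × x ∈ A) → Enclosing A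
  enclosing-before A y D (enclosing pre post split _ closed) (Ty , apart) someT =
    enclosing pre (y ∷ D ++ post) split′ someT closed′
    where
    split′ : pre ++ A ++ y ∷ D ++ post ≡ B
    split′ = trans (++-solve 5 (λ p a y d q → p ⊕ a ⊕ y ⊕ d ⊕ q ⊜ p ⊕ (a ⊕ y ⊕ d) ⊕ q) refl pre A [ y ] D post) split
    closed′ : ∀ x → T x ≡ true → x ∈ A → x ∉ pre × x ∉ y ∷ D ++ post
    closed′ x Tx x∈A = proj₁ (closed x Tx (∈-++⁺ˡ x∈A)) , notAfter
      where
      notAfter : x ∉ y ∷ D ++ post
      notAfter (here refl) = contradiction (trans (sym Tx) Ty) λ ()
      notAfter (there x∈) with ∈-++⁻ D x∈
      ... | inj₁ x∈D = apart x Tx x∈A x∈D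
      ... | inj₂ x∈post = proj₂ (closed x Tx (∈-++⁺ˡ x∈A)) x∈post

  enclosing-after : ∀ A y D → Enclosing (A ++ y ∷ D) → Apart A y D → ¬ Σ (Fin n) (λ x → T x ≡ true × x ∈ A) → Enclosing D
  enclosing-after A y D (enclosing pre post split (x₀ , Tx₀ , x₀∈C) closed) (Ty , _) noneInA =
    enclosing (pre ++ A ++ [ y ]) post split′ (x₀ , Tx₀ , x₀∈D) closed′
    where
    split′ : (pre ++ A ++ [ y ]) ++ D ++ post ≡ B
    split′ = trans (++-solve 5 (λ p a y d q → (p ⊕ a ⊕ y) ⊕ d ⊕ q ⊜ p ⊕ (a ⊕ y ⊕ d) ⊕ q) refl pre A [ y ] D post) split
    x₀∈D : x₀ ∈ D
    x₀∈D with ∈-++⁻ A x₀∈C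
    ... | inj₁ x₀∈A = contradiction (x₀ , Tx₀ , x₀∈A) noneInA
    ... | inj₂ (here refl) = contradiction (trans (sym Tx₀) Ty) λ ()
    ... | inj₂ (there x₀∈D) = x₀∈D
    closed′ : ∀ x → T x ≡ true → x ∈ D → x ∉ pre ++ A ++ [ y ] × x ∉ post
    closed′ x Tx x∈D = notBefore , proj₂ (closed x Tx (∈-++⁺ʳ A (there x∈D)))
      where
      notBefore : x ∉ pre ++ A ++ [ y ]
      notBefore x∈ with ∈-++⁻ pre x∈
      ... | inj₁ x∈pre = proj₁ (closed x Tx (∈-++⁺ʳ A (there x∈D))) x∈pre
      ... | inj₂ x∈Ay with ∈-++⁻ A x∈Ay
      ...   | inj₁ x∈A = noneInA (x , Tx , x∈A)
      ...   | inj₂ (here refl) = contradiction (trans (sym Tx) Ty) λ ()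

  narrow : ∀ k C → length C ≤ k → Enclosing C → Σ (Seq n) λ C′ → Enclosing C′ × Straddled C′
  narrow k C len enc with searchSplits straddled? C
  ... | inj₁ straddled = C , enc , straddled
  narrow zero _ len _ | inj₂ (A , y , D , refl , _) =
    contradiction (ℕP.≤-trans (ℕP.m≤n+m (suc (length D)) (length A)) (subst (_≤ 0) (length-++ A) len)) λ ()
  narrow (suc k) _ len enc | inj₂ (A , y , D , refl , apart)
    with FinP.any? (λ x → (T x ≟ᵇ true) ×-dec any? (x ≟ᶠ_) A)
  ... | yes someT = narrow k A shorter (enclosing-before A y D enc apart someT)
    where
    shorter : length A ≤ k
    shorter = ℕP.≤-pred (ℕP.≤-trans (subst (suc (length A) ≤_) (sym (ℕP.+-suc (length A) (length D))) (s≤s (ℕP.m≤m+n _ _)))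
                                    (subst (_≤ suc k) (length-++ A) len))
  ... | no noneInA = narrow k D shorter (enclosing-after A y D enc apart noneInA)
    where
    shorter : length D ≤ k
    shorter = ℕP.≤-pred (ℕP.≤-trans (ℕP.m≤n+m (suc (length D)) (length A)) (subst (_≤ suc k) (length-++ A) len))

  stuck⇒dense : Stuck → Repeated → Σ (Fin n) (λ x → T x ≡ true) → DenseBlock B
  stuck⇒dense stuck repeated (x , Tx) with narrow (length B) B ℕP.≤-refl whole
    where
    whole : Enclosing B
    whole = enclosing [] [] (++-identityʳ B) (x , Tx , ∈-count x B (ℕP.≤-trans (s≤s z≤n) (repeated x Tx)))
                      (λ _ _ _ → (λ ()) , (λ ()))
  ... | C , enc@(enclosing pre post split (y , _ , y∈C) _) , straddled =
    pre , C , post , split , ℕP.≤-trans (count-∈ y∈C) (count-≤-length y C) ,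
    straddled⇒dense stuck repeated enc straddled

  Leaving : Fin n → Seq n → Set
  Leaving v mid = T v ≡ true × Σ (Fin n) λ w → T w ≡ false × odd (count w mid) ≡ true

  leaving? : ∀ v mid → Dec (Leaving v mid)
  leaving? v mid = (T v ≟ᵇ true) ×-dec FinP.any? (λ w → (T w ≟ᵇ false) ×-dec (odd (count w mid) ≟ᵇ true))

  witness-leaving : ¬ DenseBlock B → Repeated → Σ (Fin n) (λ x → T x ≡ true) →
                    Σ (Witness B) λ e → T (Witness.v e) ≡ true × T (Witness.w e) ≡ false
  witness-leaving noDense repeated nonempty with searchGaps B leaving?
  ... | inj₁ (g , Tv , w , Tw , w-odd) = witness g w v≢w w-odd , Tv , Tw
    where
    v≢w : Gap.v g ≢ w
    v≢w refl = contradiction (trans (sym Tv) Tw) λ ()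
  ... | inj₂ none = contradiction (stuck⇒dense stuck repeated nonempty) noDense
    where
    stuck : Stuck
    stuck g Tv w Tw = ¬-not λ w-odd → none g (Tv , w , Tw , w-odd)

-- Greedy family.  Take a witness leaving T, remove its vertex from T and repeat:
-- the later witnesses have their vertex in the smaller set, so the earlier one clears them.
module _ {B : Seq n} (noDense : ¬ DenseBlock B) where

  open Connectivity using (Repeated; witness-leaving)
  open Witness

  greedy : ∀ k (T : Fin n → Bool) → #[ T ] ≡ k → Repeated {B = B} T →
           Σ (List (Witness B)) λ fam → length fam ≡ k × AllPairs Clears fam × All (λ e → T (v e) ≡ true) fam
  greedy zero T _ _ = [] , refl , [] , []
  greedy (suc k) T size repeated with witness-leaving T noDense repeated (#-nonempty T (subst (0 <_) (sym size) (s≤s z≤n)))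
  ... | e , Tv , Tw with greedy k (T ∖ v e) (ℕP.suc-injective (trans (sym (#-remove T (v e) Tv)) size))
                                (λ x Tx → repeated x (proj₁ (∖-true T Tx)))
  ... | fam , len , clears , inSmaller =
    e ∷ fam , cong suc len , All.map (λ {y} → clearsLater {y}) inSmaller ∷ clears ,
    Tv ∷ All.map (λ Ty → proj₁ (∖-true T Ty)) inSmaller
    where
    clearsLater : ∀ {y} → (T ∖ v e) (v y) ≡ true → Clears e y
    clearsLater {y} Ty with ∖-true T {v e} {v y} Ty
    ... | Tvy , vy≢ve = inj₁ (vy≢ve , λ vy≡we → contradiction (trans (sym Tvy) (trans (cong T vy≡we) Tw)) λ ())

-- A vertex occurring in a
-- run and again after the next once-vertex o has a gap containing o exactly once; these
-- crossing witnesses pay for the vertices that are counted in several runs.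
module Runs {B : Seq n} where

  open import Algebra.Solver.Monoid (++-monoid (Fin n)) using (_⊜_; _⊕_) renaming (solve to ++-solve)
  open Witness

  Once : Fin n → Set
  Once x = count x B ≡ 1

  once? : ∀ x → Dec (Once x)
  once? x = count x B ℕ.≟ 1

  onceMoves : Seq n → ℕ
  onceMoves L = length (filter once? L)

  repeatedIn : Seq n → ℕ
  repeatedIn L = #[ (λ x → occurs x L ∧ not (does (once? x))) ]

  s-split : s B ≡ onceMoves B + repeatedIn B
  s-split = begin
    s B                                                           ≡⟨ s-as-sum B ⟩
    ∑ (λ x → 𝟙 (occurs x B))                                      ≡⟨ sum-cong-≗ pointwise ⟩
    ∑ (λ x → (if does (once? x) then count x B else 0) + 𝟙 (occurs x B ∧ not (does (once? x))))
      ≡⟨ ∑-distrib-+ (λ x → if does (once? x) then count x B else 0) _ ⟩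
    ∑ (λ x → if does (once? x) then count x B else 0) + repeatedIn B
      ≡⟨ cong (_+ repeatedIn B) (sym (length-filter-as-sum once? B)) ⟩
    onceMoves B + repeatedIn B                                    ∎
    where
    open ≡-Reasoning
    pointwise : ∀ x → 𝟙 (occurs x B) ≡ (if does (once? x) then count x B else 0) + 𝟙 (occurs x B ∧ not (does (once? x)))
    pointwise x with count x B in c
    ... | 1 rewrite dec-true (any? (x ≟ᶠ_) B) (∈-count x B (ℕP.≤-reflexive (sym c))) = refl
    ... | 0 = cong 𝟙 (sym (∧-identityʳ (occurs x B)))
    ... | suc (suc _) = cong 𝟙 (sym (∧-identityʳ (occurs x B)))

  NoOnce : Seq n → Set
  NoOnce = All (λ x → ¬ Once x)

  Run : Seq n → Set
  Run Q = Σ (Seq n) λ pre → Σ (Seq n) λ post → pre ++ Q ++ post ≡ B × NoOnce Q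

  once-after : ∀ pre o L → pre ++ o ∷ L ≡ B → Once o → o ∉ L
  once-after pre o L split once o∈L = contradiction (ℕP.≤-trans twice inB) (λ 2≤1 → ℕP.<-irrefl refl 2≤1)
    where
    twice : 2 ≤ count o (o ∷ L)
    twice = subst (2 ≤_) (sym (count-self o L)) (s≤s (count-∈ o∈L))
    inB : count o (o ∷ L) ≤ 1
    inB = subst (count o (o ∷ L) ≤_) (trans (cong (count o) split) once) (count-suffix o pre (o ∷ L))

  data Runs : Seq n → Set where
    lastRun : ∀ {Q} → NoOnce Q → Runs Q
    cutAt : ∀ {Q o L} → NoOnce Q → Once o → Runs L → Runs (Q ++ o ∷ L)

  runs : ∀ L → Runs L
  runs [] = lastRun []
  runs (x ∷ L) with once? x
  ... | yes once = cutAt [] once (runs L)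
  ... | no ¬once = prepend (runs L)
    where
    prepend : ∀ {L} → Runs L → Runs (x ∷ L)
    prepend (lastRun q) = lastRun (¬once ∷ q)
    prepend (cutAt q once r) = cutAt (¬once ∷ q) once r

  Inside : Seq n → Witness B → Set
  Inside L e = ¬ Once (v e) × mid e ⊆ L

  record RunsFamily (L : Seq n) : Set where
    field
      pieces : List (Seq n)
      pieces-runs : All Run pieces
      fam : List (Witness B)
      clears : AllPairs Clears fam
      inside : All (Inside L) fam
      length-pieces : length L ≡ onceMoves L + sum (map length pieces)
      size-pieces : sum (map s pieces) ≤ repeatedIn L + length fam

  module Crossing (pre Q : Seq n) (o : Fin n) (L : Seq n) (split : pre ++ Q ++ o ∷ L ≡ B)
                  (noOnce : NoOnce Q) (once : Once o) where

    o∉L : o ∉ L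
    o∉L = once-after (pre ++ Q) o L
            (trans (++-solve 4 (λ p q o l → (p ⊕ q) ⊕ o ⊕ l ⊜ p ⊕ q ⊕ o ⊕ l) refl pre Q [ o ] L) split) once

    o∉Q : o ∉ Q
    o∉Q o∈Q = All.lookup noOnce o∈Q once

    -- a vertex x occurring in Q and in L has a gap from its last move in Q to its
    -- first move in L; this gap contains o exactly once
    crossWitness : ∀ x → x ∈ Q → x ∈ L → Σ (Witness B) λ e → v e ≡ x × w e ≡ o × Inside (Q ++ o ∷ L) e
    crossWitness x x∈Q x∈L with lastOcc x Q x∈Q | firstOcc x L x∈L
    ... | Q₁ , Q₂ , refl , x∉Q₂ | L₁ , L₂ , refl , x∉L₁ =
      witness crossGap o x≢o o-odd , refl , refl , All.lookup noOnce x∈Q , inside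
      where
      gapMid : Seq n
      gapMid = Q₂ ++ o ∷ L₁
      x≢o : x ≢ o
      x≢o refl = All.lookup noOnce x∈Q once
      x∉mid : x ∉ gapMid
      x∉mid x∈ with ∈-++⁻ Q₂ x∈
      ... | inj₁ x∈Q₂ = x∉Q₂ x∈Q₂
      ... | inj₂ (here x≡o) = x≢o x≡o
      ... | inj₂ (there x∈L₁) = x∉L₁ x∈L₁
      regroup : (Q₁ ++ [ x ]) ++ gapMid ++ x ∷ L₂ ≡ (Q₁ ++ x ∷ Q₂) ++ o ∷ (L₁ ++ x ∷ L₂)
      regroup = ++-solve 6 (λ q₁ x q₂ o l₁ l₂ →
        (q₁ ⊕ x) ⊕ (q₂ ⊕ o ⊕ l₁) ⊕ x ⊕ l₂ ⊜ (q₁ ⊕ x ⊕ q₂) ⊕ o ⊕ (l₁ ⊕ x ⊕ l₂)) refl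
                  Q₁ [ x ] Q₂ [ o ] L₁ L₂
      crossGap : Gap B
      crossGap = gap (pre ++ Q₁) x gapMid L₂ (trans (++-solve 7 (λ p q₁ x q₂ o l₁ l₂ →
            (p ⊕ q₁) ⊕ x ⊕ (q₂ ⊕ o ⊕ l₁) ⊕ x ⊕ l₂ ⊜ p ⊕ (q₁ ⊕ x ⊕ q₂) ⊕ o ⊕ (l₁ ⊕ x ⊕ l₂)) refl
            pre Q₁ [ x ] Q₂ [ o ] L₁ L₂) split) x∉mid
      o-odd : odd (count o gapMid) ≡ true
      o-odd rewrite count-++ o Q₂ (o ∷ L₁) | count-self o L₁
                  | count-∉ {L = Q₂} (λ o∈Q₂ → o∉Q (∈-++⁺ʳ Q₁ (there o∈Q₂)))
                  | count-∉ {L = L₁} (λ o∈L₁ → o∉L (∈-++⁺ˡ o∈L₁)) = refl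
      inside : gapMid ⊆ (Q₁ ++ x ∷ Q₂) ++ o ∷ (L₁ ++ x ∷ L₂)
      inside y∈ = subst (_ ∈_) regroup (∈-++⁺ʳ (Q₁ ++ [ x ]) (∈-++⁺ˡ y∈))

    crossFamily : ∀ xs → All (λ x → x ∈ Q × x ∈ L) xs → Unique xs →
                  Σ (List (Witness B)) λ cr → length cr ≡ length xs × AllPairs Clears cr ×
                    All (λ e → v e ∈ xs × w e ≡ o × Inside (Q ++ o ∷ L) e) cr
    crossFamily [] [] [] = [] , refl , [] , []
    crossFamily (x ∷ xs) ((x∈Q , x∈L) ∷ both) (x∉xs ∷ unique) with crossFamily xs both unique | crossWitness x x∈Q x∈L
    ... | cr , len , clears , info | e , ve≡x , we≡o , inside =
      e ∷ cr , cong suc len , All.map (λ {y} → clearsLater {y}) info ∷ clears ,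
      (here ve≡x , we≡o , inside) ∷ All.map (λ (i , w≡ , ins) → there i , w≡ , ins) info
      where
      -- later crossing witnesses have other vertices, none of them the once-vertex o
      clearsLater : ∀ {y} → v y ∈ xs × w y ≡ o × Inside (Q ++ o ∷ L) y → Clears e y
      clearsLater (vy∈xs , _ , ¬once , _) =
        inj₁ ((λ vy≡ve → All.lookup x∉xs vy∈xs (sym (trans vy≡ve ve≡x))) ,
              λ vy≡we → ¬once (subst Once (sym (trans vy≡we we≡o)) once))

    both? : ∀ x → Dec (x ∈ Q × x ∈ L)
    both? x = any? (x ≟ᶠ_) Q ×-dec any? (x ≟ᶠ_) L

    crossings : List (Fin n)
    crossings = filter both? (allFin n)

    -- the vertex sets of Q and of L overlap only in the crossings
    count-crossing : s Q + repeatedIn L ≤ repeatedIn (Q ++ o ∷ L) + length crossings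
    count-crossing = begin
      s Q + repeatedIn L
        ≡⟨ cong (_+ repeatedIn L) (s-as-sum Q) ⟩
      #[ (λ x → occurs x Q) ] + repeatedIn L
        ≡⟨ sym (∑-distrib-+ (λ x → 𝟙 (occurs x Q)) _) ⟩
      ∑ (λ x → 𝟙 (occurs x Q) + 𝟙 (occurs x L ∧ not (does (once? x))))
        ≤⟨ ∑-mono _ _ pointwise ⟩
      ∑ (λ x → 𝟙 (occurs x (Q ++ o ∷ L) ∧ not (does (once? x))) + 𝟙 (does (both? x)))
        ≡⟨ ∑-distrib-+ (λ x → 𝟙 (occurs x (Q ++ o ∷ L) ∧ not (does (once? x)))) _ ⟩
      repeatedIn (Q ++ o ∷ L) + #[ (λ x → does (both? x)) ]
        ≡⟨ cong (repeatedIn (Q ++ o ∷ L) +_) (sym (filter-allFin both?)) ⟩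
      repeatedIn (Q ++ o ∷ L) + length crossings ∎
      where
      open ℕP.≤-Reasoning
      pointwise : ∀ x → 𝟙 (occurs x Q) + 𝟙 (occurs x L ∧ not (does (once? x))) ≤
                        𝟙 (occurs x (Q ++ o ∷ L) ∧ not (does (once? x))) + 𝟙 (does (both? x))
      pointwise x with any? (x ≟ᶠ_) Q | any? (x ≟ᶠ_) L
      ... | yes x∈Q | yes _
        rewrite dec-true (any? (x ≟ᶠ_) (Q ++ o ∷ L)) (∈-++⁺ˡ x∈Q) | dec-false (once? x) (All.lookup noOnce x∈Q) = ℕP.≤-refl
      ... | yes x∈Q | no _
        rewrite dec-true (any? (x ≟ᶠ_) (Q ++ o ∷ L)) (∈-++⁺ˡ x∈Q) | dec-false (once? x) (All.lookup noOnce x∈Q) = ℕP.≤-refl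
      ... | no _ | yes x∈L rewrite dec-true (any? (x ≟ᶠ_) (Q ++ o ∷ L)) (∈-++⁺ʳ Q (there x∈L)) = ℕP.m≤m+n _ 0
      ... | no _ | no _ = z≤n

    crossing : Σ (List (Witness B)) λ cr → length cr ≡ length crossings × AllPairs Clears cr ×
                 All (λ e → v e ∈ crossings × w e ≡ o × Inside (Q ++ o ∷ L) e) cr
    crossing = crossFamily crossings (AllP.all-filter both? (allFin n)) (filter⁺ both? (allFin⁺ n))

    -- a crossing witness clears every witness inside L: those of other vertices are off
    -- its row, and a gap of its own vertex inside L does not contain o
    cross-clears-inside : ∀ {e y} → w e ≡ o → Inside L y → Clears e y
    cross-clears-inside {e} {y} we≡o (¬once , mid⊆L) with v y ≟ᶠ v e
    ... | yes vy≡ve = inj₂ (vy≡ve , even)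
      where
      even : odd (count (w e) (mid y)) ≡ false
      even rewrite we≡o | count-∉ {L = mid y} (o∉L ∘ mid⊆L) = refl
    ... | no vy≢ve = inj₁ (vy≢ve , λ vy≡we → ¬once (subst Once (sym (trans vy≡we we≡o)) once))

    widen : ∀ {e} → Inside L e → Inside (Q ++ o ∷ L) e
    widen (¬once , mid⊆L) = ¬once , ∈-++⁺ʳ Q ∘ there ∘ mid⊆L

    onceMoves-cross : onceMoves (Q ++ o ∷ L) ≡ suc (onceMoves L)
    onceMoves-cross = cong length (trans (filter-++ once? Q (o ∷ L))
      (cong₂ _++_ (filter-none once? noOnce) (filter-accept once? once)))

    step : RunsFamily L → RunsFamily (Q ++ o ∷ L)
    step rest = record
      { pieces = Q ∷ R.pieces
      ; pieces-runs = (pre , o ∷ L , split , noOnce) ∷ R.pieces-runs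
      ; fam = cr ++ R.fam
      ; clears = AllPairsP.++⁺ cr-clears R.clears
                   (All.map (λ {e} (_ , we≡o , _) → All.map (λ {y} → cross-clears-inside {e} {y} we≡o) R.inside) cr-info)
      ; inside = AllP.++⁺ (All.map (proj₂ ∘ proj₂) cr-info) (All.map (λ {e} → widen {e}) R.inside)
      ; length-pieces = length-eq
      ; size-pieces = size-le
      }
      where
      module R = RunsFamily rest
      cr : List (Witness B)
      cr = proj₁ crossing
      cr-clears : AllPairs Clears cr
      cr-clears = proj₁ (proj₂ (proj₂ crossing))
      cr-info : All (λ e → v e ∈ crossings × w e ≡ o × Inside (Q ++ o ∷ L) e) cr
      cr-info = proj₂ (proj₂ (proj₂ crossing))

      length-eq : length (Q ++ o ∷ L) ≡ onceMoves (Q ++ o ∷ L) + sum (map length (Q ∷ R.pieces))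
      length-eq rewrite length-++ Q {o ∷ L} | R.length-pieces | onceMoves-cross =
        solve 3 (λ q x r → q :+ (con 1 :+ (x :+ r)) := (con 1 :+ x) :+ (q :+ r)) refl
          (length Q) (onceMoves L) (sum (map length R.pieces))
        where open ℕ-Solver

      size-le : sum (map s (Q ∷ R.pieces)) ≤ repeatedIn (Q ++ o ∷ L) + length (cr ++ R.fam)
      size-le = begin
        s Q + sum (map s R.pieces)                            ≤⟨ ℕP.+-monoʳ-≤ (s Q) R.size-pieces ⟩
        s Q + (repeatedIn L + length R.fam)                   ≡⟨ sym (ℕP.+-assoc (s Q) (repeatedIn L) (length R.fam)) ⟩
        (s Q + repeatedIn L) + length R.fam                   ≤⟨ ℕP.+-monoˡ-≤ (length R.fam) count-crossing ⟩
        (repeatedIn (Q ++ o ∷ L) + length crossings) + length R.fam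
          ≡⟨ cong (λ k → (repeatedIn (Q ++ o ∷ L) + k) + length R.fam) (sym (proj₁ (proj₂ crossing))) ⟩
        (repeatedIn (Q ++ o ∷ L) + length cr) + length R.fam  ≡⟨ ℕP.+-assoc (repeatedIn (Q ++ o ∷ L)) (length cr) (length R.fam) ⟩
        repeatedIn (Q ++ o ∷ L) + (length cr + length R.fam)  ≡⟨ cong (repeatedIn (Q ++ o ∷ L) +_) (sym (length-++ cr)) ⟩
        repeatedIn (Q ++ o ∷ L) + length (cr ++ R.fam)        ∎
        where open ℕP.≤-Reasoning

  runsFamily : ∀ pre L → pre ++ L ≡ B → Runs L → RunsFamily L
  runsFamily pre L split (lastRun noOnce) = record
    { pieces = [ L ]
    ; pieces-runs = (pre , [] , trans (cong (pre ++_) (++-identityʳ L)) split , noOnce) ∷ []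
    ; fam = []
    ; clears = []
    ; inside = []
    ; length-pieces = sym (trans (cong (_+ (length L + 0)) (cong length (filter-none once? noOnce))) (ℕP.+-identityʳ _))
    ; size-pieces = subst₂ _≤_ (sym (ℕP.+-identityʳ (s L))) (sym (ℕP.+-identityʳ (repeatedIn L)))
                      (subst (_≤ repeatedIn L) (sym (s-as-sum L)) (∑-mono _ _ pointwise))
    }
    where
    pointwise : ∀ x → 𝟙 (occurs x L) ≤ 𝟙 (occurs x L ∧ not (does (once? x)))
    pointwise x with any? (x ≟ᶠ_) L
    ... | yes x∈L rewrite dec-false (once? x) (All.lookup noOnce x∈L) = ℕP.≤-refl
    ... | no _ = z≤n
  runsFamily pre _ split (cutAt {Q} {o} {L} noOnce once r) =
    Crossing.step pre Q o L split noOnce once (runsFamily (pre ++ Q ++ [ o ]) L split′ r)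
    where
    split′ : (pre ++ Q ++ [ o ]) ++ L ≡ B
    split′ = trans (++-solve 4 (λ p q o l → (p ⊕ q ⊕ o) ⊕ l ⊜ p ⊕ q ⊕ o ⊕ l) refl pre Q [ o ] L) split

ℕtoℚ-mkℚ : ∀ k → ℕtoℚ k ≡ mkℚ (ℤ.+ k) 0 (Coprimality.sym (Coprimality.1-coprimeTo k))
ℕtoℚ-mkℚ k = ℚP.normalize-coprime (Coprimality.sym (Coprimality.1-coprimeTo k))

ℕtoℚ-+ : ∀ a b → ℕtoℚ (a ℕ.+ b) ≡ ℕtoℚ a ℚ.+ ℕtoℚ b
ℕtoℚ-+ a b = ℚP.toℚᵘ-injective (ℚᵘP.≃-trans unnormalised (ℚᵘP.≃-sym (ℚP.toℚᵘ-homo-+ (ℕtoℚ a) (ℕtoℚ b))))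
  where
  unnormalised : toℚᵘ (ℕtoℚ (a ℕ.+ b)) ℚᵘ.≃ toℚᵘ (ℕtoℚ a) ℚᵘ.+ toℚᵘ (ℕtoℚ b)
  unnormalised rewrite ℕtoℚ-mkℚ (a ℕ.+ b) | ℕtoℚ-mkℚ a | ℕtoℚ-mkℚ b = ℚᵘ.*≡* (begin
    ℤ.+ (a ℕ.+ b) ℤ.* ℤ.+ 1                    ≡⟨ ℤP.*-identityʳ _ ⟩
    ℤ.+ (a ℕ.+ b)                              ≡⟨ ℤP.pos-+ a b ⟩
    ℤ.+ a ℤ.+ ℤ.+ b                            ≡⟨ sym (cong₂ ℤ._+_ (ℤP.*-identityʳ (ℤ.+ a)) (ℤP.*-identityʳ (ℤ.+ b))) ⟩
    ℤ.+ a ℤ.* ℤ.+ 1 ℤ.+ ℤ.+ b ℤ.* ℤ.+ 1        ≡⟨ sym (ℤP.*-identityʳ _) ⟩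
    (ℤ.+ a ℤ.* ℤ.+ 1 ℤ.+ ℤ.+ b ℤ.* ℤ.+ 1) ℤ.* ℤ.+ 1  ∎)
    where open ≡-Reasoning

ℕtoℚ-mono : ∀ {a b} → a ℕ.≤ b → ℕtoℚ a ℚ.≤ ℕtoℚ b
ℕtoℚ-mono {a} {b} a≤b rewrite ℕtoℚ-mkℚ a | ℕtoℚ-mkℚ b =
  ℚ.*≤* (subst₂ ℤ._≤_ (sym (ℤP.*-identityʳ (ℤ.+ a))) (sym (ℤP.*-identityʳ (ℤ.+ b))) (ℤ.+≤+ a≤b))

ℕtoℚ-nonNeg : ∀ k → 0ℚ ℚ.≤ ℕtoℚ k
ℕtoℚ-nonNeg k = ℕtoℚ-mono {0} {k} ℕ.z≤n

1+-nonNeg : ∀ β → 0ℚ ℚ.≤ β → 0ℚ ℚ.≤ 1ℚ ℚ.+ β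
1+-nonNeg β 0≤β = ℚP.+-mono-≤ {0ℚ} {1ℚ} (ℚP.≤ᵇ⇒≤ tt) 0≤β

sum-bound : ∀ {A : Set} (c : ℚ) (f g : A → ℕ) xs → All (λ x → ℕtoℚ (f x) ℚ.≤ c ℚ.* ℕtoℚ (g x)) xs →
            ℕtoℚ (sum (map f xs)) ℚ.≤ c ℚ.* ℕtoℚ (sum (map g xs))
sum-bound c f g [] [] = ℚP.≤-reflexive (sym (ℚP.*-zeroʳ c))
sum-bound c f g (x ∷ xs) (fx≤ ∷ rest) = begin
  ℕtoℚ (f x ℕ.+ sum (map f xs))                   ≡⟨ ℕtoℚ-+ (f x) _ ⟩
  ℕtoℚ (f x) ℚ.+ ℕtoℚ (sum (map f xs))               ≤⟨ ℚP.+-mono-≤ fx≤ (sum-bound c f g xs rest) ⟩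
  c ℚ.* ℕtoℚ (g x) ℚ.+ c ℚ.* ℕtoℚ (sum (map g xs))       ≡⟨ sym (ℚP.*-distribˡ-+ c _ _) ⟩
  c ℚ.* (ℕtoℚ (g x) ℚ.+ ℕtoℚ (sum (map g xs)))         ≡⟨ cong (c ℚ.*_) (sym (ℕtoℚ-+ (g x) _)) ⟩
  c ℚ.* ℕtoℚ (g x ℕ.+ sum (map g xs))                ∎
  where open ℚP.≤-Reasoning

at-most-double : ∀ β k → β ℚ.≤ 1ℚ → (1ℚ ℚ.+ β) ℚ.* ℕtoℚ k ℚ.≤ ℕtoℚ (2 ℕ.* k)
at-most-double β k β≤1 = begin
  (1ℚ ℚ.+ β) ℚ.* ℕtoℚ k            ≤⟨ ℚP.*-monoʳ-≤-nonNeg (ℕtoℚ k) (ℚP.+-monoʳ-≤ 1ℚ β≤1) ⟩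
  (1ℚ ℚ.+ 1ℚ) ℚ.* ℕtoℚ k           ≡⟨ solve 1 (λ x → (con 1ℚ :+ con 1ℚ) :* x := x :+ (x :+ con 0ℚ)) refl (ℕtoℚ k) ⟩
  ℕtoℚ k ℚ.+ (ℕtoℚ k ℚ.+ 0ℚ)       ≡⟨ sym (trans (ℕtoℚ-+ k _) (cong (λ q → ℕtoℚ k ℚ.+ q) (ℕtoℚ-+ k 0))) ⟩
  ℕtoℚ (2 ℕ.* k)               ∎
  where
  open ℚP.≤-Reasoning
  open ℚ-Solver
  instance _ = ℚ.nonNegative (ℕtoℚ-nonNeg k)

-- With X once-vertices and D repeated vertices, the runs have total
-- length L ≤ (1+β)S and total size S ≤ D + M; combined with (1+β)(X + D) ≤ X + L this
-- gives βX ≤ (1+β)M, hence β(X + D) ≤ (1+2β)r for any r ≥ D, M.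
final-estimate : ∀ (β X D M L S r : ℚ) → 0ℚ ℚ.≤ β →
                 (1ℚ ℚ.+ β) ℚ.* (X ℚ.+ D) ℚ.≤ X ℚ.+ L → L ℚ.≤ (1ℚ ℚ.+ β) ℚ.* S → S ℚ.≤ D ℚ.+ M →
                 D ℚ.≤ r → M ℚ.≤ r →
                 β ℚ.* (X ℚ.+ D) ℚ.≤ (1ℚ ℚ.+ β ℚ.+ β) ℚ.* r
final-estimate β X D M L S r 0≤β critical runs size D≤r M≤r = begin
  β ℚ.* (X ℚ.+ D)                 ≡⟨ ℚP.*-distribˡ-+ β X D ⟩
  β ℚ.* X ℚ.+ β ℚ.* D
    ≤⟨ ℚP.+-mono-≤ (ℚP.≤-trans onceBound (ℚP.*-monoˡ-≤-nonNeg (1ℚ ℚ.+ β) M≤r)) (ℚP.*-monoˡ-≤-nonNeg β D≤r) ⟩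
  (1ℚ ℚ.+ β) ℚ.* r ℚ.+ β ℚ.* r        ≡⟨ sym (ℚP.*-distribʳ-+ r (1ℚ ℚ.+ β) β) ⟩
  (1ℚ ℚ.+ β ℚ.+ β) ℚ.* r            ∎
  where
  open ℚP.≤-Reasoning
  open ℚ-Solver
  instance
    _ = ℚ.nonNegative 0≤β
    _ = ℚ.nonNegative (1+-nonNeg β 0≤β)
  -- both sides of (1+β)(X+D) ≤ X + (1+β)(D+M) share the summand X + (1+β)D
  shared : ℚ
  shared = X ℚ.+ (1ℚ ℚ.+ β) ℚ.* D
  chain : (1ℚ ℚ.+ β) ℚ.* (X ℚ.+ D) ℚ.≤ X ℚ.+ (1ℚ ℚ.+ β) ℚ.* (D ℚ.+ M)
  chain = ℚP.≤-trans critical (ℚP.+-monoʳ-≤ X (ℚP.≤-trans runs (ℚP.*-monoˡ-≤-nonNeg (1ℚ ℚ.+ β) size)))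
  onceBound : β ℚ.* X ℚ.≤ (1ℚ ℚ.+ β) ℚ.* M
  onceBound = subst₂ ℚ._≤_
    (solve 3 (λ β X D → (con 1ℚ :+ β) :* (X :+ D) :+ (:- (X :+ (con 1ℚ :+ β) :* D)) := β :* X) refl β X D)
    (solve 4 (λ β X D M → (X :+ (con 1ℚ :+ β) :* (D :+ M)) :+ (:- (X :+ (con 1ℚ :+ β) :* D)) := (con 1ℚ :+ β) :* M) refl β X D M)
    (ℚP.+-monoˡ-≤ (ℚ.- shared) chain)

missing⇒shorter : ∀ {B : Seq n} pre C post {u} → pre ++ C ++ post ≡ B → u ∈ B → u ∉ C → length C < length B
missing⇒shorter (p ∷ pre) C post refl u∈B u∉C
  rewrite length-++ pre {C ++ post} | length-++ C {post} =
  s≤s (ℕP.≤-trans (ℕP.m≤m+n (length C) (length post)) (ℕP.m≤n+m _ (length pre)))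
missing⇒shorter [] C [] refl u∈B u∉C with ∈-++⁻ C u∈B
... | inj₁ u∈C = contradiction u∈C u∉C
... | inj₂ ()
missing⇒shorter [] C (q ∷ post) refl u∈B u∉C
  rewrite length-++ C {q ∷ post} = ℕP.m<m+n (length C) (s≤s z≤n)

module CriticalBlock {β : ℚ} {B : Seq n} (critical : Critical β B) (u : Fin n) (once-u : count u B ≡ 1) where

  open Runs {B = B}

  u∈B : u ∈ B
  u∈B = ∈-count u B (ℕP.≤-reflexive (sym once-u))

  run-bound : 0ℚ ℚ.≤ β → ∀ Q → Run Q → ℕtoℚ (length Q) ℚ.≤ (1ℚ ℚ.+ β) ℚ.* ℕtoℚ (s Q)
  run-bound 0≤β [] _ = ℚP.≤-trans (ℚP.≤-reflexive (sym (ℚP.*-zeroʳ (1ℚ ℚ.+ β))))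
                                  (ℚP.*-monoˡ-≤-nonNeg (1ℚ ℚ.+ β) (ℕtoℚ-nonNeg (s {n} [])))
    where instance _ = ℚ.nonNegative (1+-nonNeg β 0≤β)
  run-bound 0≤β Q@(q ∷ _) (pre , post , split , noOnce) =
    ℚP.<⇒≤ (proj₂ critical Q (pre , post , split , s≤s z≤n , missing⇒shorter pre Q post split u∈B u∉Q))
    where
    u∉Q : u ∉ Q
    u∉Q u∈Q = All.lookup noOnce u∈Q once-u

  -- for β ≤ 1 criticality forbids dense blocks: such a block cannot contain u, so it is
  -- a strict block and ℓ(C) < (1+β)s(C) ≤ 2s(C) ≤ ℓ(C)
  no-dense-block : β ℚ.≤ 1ℚ → ¬ DenseBlock B
  no-dense-block β≤1 (pre , C , post , split , 0<ℓC , twice) =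
    ℚP.<-irrefl refl (ℚP.<-≤-trans sparse (ℚP.≤-trans (at-most-double β (s C) β≤1) (ℕtoℚ-mono (dense C twice))))
    where
    u∉C : u ∉ C
    u∉C u∈C = ℕP.<-irrefl refl (ℕP.≤-trans (twice u u∈C)
                (subst (count u C ≤_) (trans (cong (count u) split) once-u) (count-infix u pre C post)))
    sparse : ℕtoℚ (length C) ℚ.< (1ℚ ℚ.+ β) ℚ.* ℕtoℚ (s C)
    sparse = proj₂ critical C (pre , post , split , 0<ℓC , missing⇒shorter pre C post split u∈B u∉C)

  repeatedVertex : Fin n → Bool
  repeatedVertex x = occurs x B ∧ not (does (once? x))

  repeated-twice : Connectivity.Repeated {B = B} repeatedVertex
  repeated-twice x repeated with count x B in c | any? (x ≟ᶠ_) B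
  ... | zero | yes x∈B = contradiction (subst (1 ≤_) c (count-∈ x∈B)) λ ()
  ... | zero | no _ = contradiction repeated λ ()
  ... | suc zero | yes _ = contradiction repeated λ ()
  ... | suc zero | no _ = contradiction repeated λ ()
  ... | suc (suc _) | _ = s≤s (s≤s z≤n)

  rank-repeated : β ℚ.≤ 1ℚ → ∀ τ₀ → RankAtLeast (P B τ₀) (repeatedIn B)
  rank-repeated β≤1 τ₀ with greedy (no-dense-block β≤1) (repeatedIn B) repeatedVertex refl repeated-twice
  ... | fam , length≡ , clears , _ = subst (RankAtLeast (P B τ₀)) length≡ (witnesses⇒rank τ₀ fam clears)

  family : RunsFamily B
  family = runsFamily [] B refl (runs B)

  open RunsFamily family

  rank-runs : ∀ τ₀ → RankAtLeast (P B τ₀) (length fam)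
  rank-runs τ₀ = witnesses⇒rank τ₀ fam clears

  estimate : 0ℚ ℚ.≤ β → ∀ r → repeatedIn B ≤ r → length fam ≤ r →
             β ℚ.* ℕtoℚ (s B) ℚ.≤ (1ℚ ℚ.+ β ℚ.+ β) ℚ.* ℕtoℚ r
  estimate 0≤β r D≤r M≤r = subst (λ q → β ℚ.* q ℚ.≤ (1ℚ ℚ.+ β ℚ.+ β) ℚ.* ℕtoℚ r) (sym s≡)
    (final-estimate β X D F L S (ℕtoℚ r) 0≤β top runsLength runsSize (ℕtoℚ-mono D≤r) (ℕtoℚ-mono M≤r))
    where
    X D F L S : ℚ
    X = ℕtoℚ (onceMoves B)
    D = ℕtoℚ (repeatedIn B)
    F = ℕtoℚ (length fam)
    L = ℕtoℚ (sum (map length pieces))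
    S = ℕtoℚ (sum (map s pieces))
    s≡ : ℕtoℚ (s B) ≡ X ℚ.+ D
    s≡ = trans (cong ℕtoℚ s-split) (ℕtoℚ-+ (onceMoves B) (repeatedIn B))
    ℓ≡ : ℕtoℚ (length B) ≡ X ℚ.+ L
    ℓ≡ = trans (cong ℕtoℚ length-pieces) (ℕtoℚ-+ (onceMoves B) (sum (map length pieces)))
    top : (1ℚ ℚ.+ β) ℚ.* (X ℚ.+ D) ℚ.≤ X ℚ.+ L
    top = subst₂ (λ a b → (1ℚ ℚ.+ β) ℚ.* a ℚ.≤ b) s≡ ℓ≡ (proj₁ critical)
    runsLength : L ℚ.≤ (1ℚ ℚ.+ β) ℚ.* S
    runsLength = sum-bound (1ℚ ℚ.+ β) length s pieces (All.map (λ {Q} → run-bound 0≤β Q) pieces-runs)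
    runsSize : S ℚ.≤ D ℚ.+ F
    runsSize = subst (S ℚ.≤_) (ℕtoℚ-+ (repeatedIn B) (length fam)) (ℕtoℚ-mono size-pieces)

corollary3p16 : (n : ℕ) (β : ℚ) → 0ℚ ℚ.< β → β ℚ.≤ 1ℚ →
  (B : Seq n) → Critical β B →
  Σ (Fin n) (λ v → count v B ≡ 1) →
  (τ₀ : Config n) →
  Σ ℕ λ r → RankAtLeast (P B τ₀) r × (β ℚ.* ℕtoℚ (s B) ℚ.≤ (1ℚ ℚ.+ β ℚ.+ β) ℚ.* ℕtoℚ r)
corollary3p16 n β 0<β β≤1 B critical (u , once-u) τ₀ =
  repeatedIn B ⊔ length fam ,
  rank-⊔ (P B τ₀) (rank-repeated β≤1 τ₀) (rank-runs τ₀) ,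
  estimate (ℚP.<⇒≤ 0<β) _ (ℕP.m≤m⊔n (repeatedIn B) (length fam)) (ℕP.m≤n⊔m (repeatedIn B) (length fam))
  where
  open Runs {B = B}
  open CriticalBlock {β = β} {B = B} critical u once-u
  open RunsFamily family
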